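{- Let $T$ be a numerical semigroup, let $d\ge 2$, and let $S$ be the $T$-stripe GNS in $\mathbb{N}^d$, i.e. $S=\mathbb{N}^d\setminus\big(\{\mathbf{x}\in\mathbb{N}^d:0<|\mathbf{x}|<\operatorname{m}(T)\}\cup\bigcup_{i=1}^d\{h\mathbf{e}_i:h\in\operatorname{H}(T)\}\big)$. Then $\operatorname{e}(S)\ge d(\operatorname{t}(S)+1)$. In particular $S$ satisfies the generalized Wilf's conjecture, i.e. $\operatorname{e}(S)\operatorname{n}(S)\ge d\operatorname{c}(S)$.
   Context: $\mathbb{N}$ is the set of non-negative integers; $\mathbf{e}_i$ are the standard basis vectors; $|\mathbf{x}|$ is the sum of coordinates; $\le$ on $\mathbb{N}^d$ is the componentwise partial order. A GNS is a submonoid $S\subseteq\mathbb{N}^d$ with finite complement $\operatorname{H}(S)=\mathbb{N}^d\setminus S$; a numerical semigroup is the case $d=1$, and $\operatorname{m}(T)=\min(T\setminus\{0\})$. $\operatorname{e}(S)$ is the cardinality of the minimal system of generators of $S$; $\operatorname{PF}(S)=\{\mathbf{x}\in\operatorname{H}(S):\mathbf{x}+\mathbf{s}\in S\ \forall\mathbf{s}\in S\setminus\{\mathbf{0}\}\}$, $\operatorname{t}(S)=|\operatorname{PF}(S)|$; $\operatorname{n}(S)=|\{\mathbf{s}\in S:\mathbf{s}\le\mathbf{h}\text{ for some }\mathbf{h}\in\operatorname{H}(S)\}|$; $\operatorname{c}(S)=|\{\mathbf{n}\in\mathbb{N}^d:\mathbf{n}\le\mathbf{h}\text{ for some }\mathbf{h}\in\operatorname{H}(S)\}|$.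 -}

module Defs where

open import Data.Nat using (ℕ; zero; suc; _+_; _*_; _≤_; _<_)
open import Data.Fin using (Fin)
import Data.Fin as Fin
open import Data.Vec using (Vec; tabulate; zipWith; replicate)
import Data.Vec as Vec
open import Data.Vec.Relation.Binary.Pointwise.Inductive using (Pointwise)
open import Data.List using (List; length)
open import Data.List.Membership.Propositional using (_∈_)
open import Data.List.Relation.Unary.Unique.Propositional using (Unique)
open import Data.Product using (Σ; ∃; ∃-syntax; _×_)
open import Data.Bool using (if_then_else_)
open import Relation.Nullary using (¬_)
open import Relation.Nullary.Decidable using (⌊_⌋)
open import Relation.Binary.PropositionalEquality using (_≡_; _≢_)

record NumericalSemigroup : Set₁ where
  field
    _∈T      : ℕ → Set
    zero∈T   : 0 ∈T
    +-closed : ∀ a b → a ∈T → b ∈T → (a + b) ∈T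
    cofinite : ∃[ F ] (∀ n → F < n → n ∈T)

open NumericalSemigroup public

IsMultiplicity : NumericalSemigroup → ℕ → Set
IsMultiplicity T m = 0 < m × (_∈T T m) × (∀ k → 0 < k → k < m → ¬ (_∈T T k))

Pt : ℕ → Set
Pt d = Vec ℕ d

∣_∣ₚ : ∀ {d} → Pt d → ℕ
∣ x ∣ₚ = Vec.sum x

_⊕_ : ∀ {d} → Pt d → Pt d → Pt d
_⊕_ = zipWith _+_

𝟎 : ∀ {d} → Pt d
𝟎 = replicate _ 0

_≤ₚ_ : ∀ {d} → Pt d → Pt d → Set
_≤ₚ_ = Pointwise _≤_

_·e_ : ∀ {d} → ℕ → Fin d → Pt d
h ·e i = tabulate (λ j → if ⌊ i Fin.≟ j ⌋ then h else 0)

InStripe : NumericalSemigroup → (m : ℕ) → (d : ℕ) → Pt d → Set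
InStripe T m d x =
  ¬ (0 < ∣ x ∣ₚ × ∣ x ∣ₚ < m) ×
  ¬ (Σ (Fin d) λ i → Σ ℕ λ h → ¬ (_∈T T h) × x ≡ h ·e i)

module Invariants {d : ℕ} (S : Pt d → Set) where

  Hole : Pt d → Set
  Hole x = ¬ S x

  MinGen : Pt d → Set
  MinGen x = S x × x ≢ 𝟎 ×
    ¬ (Σ (Pt d) λ a → Σ (Pt d) λ b →
         S a × S b × a ≢ 𝟎 × b ≢ 𝟎 × x ≡ a ⊕ b)

  PF : Pt d → Set
  PF x = Hole x × (∀ s → S s → s ≢ 𝟎 → S (x ⊕ s))

  NElt : Pt d → Set
  NElt s = S s × (Σ (Pt d) λ h → Hole h × s ≤ₚ h)

  CElt : Pt d → Set
  CElt n = Σ (Pt d) λ h → Hole h × n ≤ₚ h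

HasCard : ∀ {d} → (Pt d → Set) → ℕ → Set
HasCard {d} P k =
  Σ (List (Pt d)) λ l →
    Unique l × (∀ x → (x ∈ l → P x) × (P x → x ∈ l)) × length l ≡ k

{-# OPTIONS --safe #-}
-- Let m = m(T) and call B = {y : 0 < |y| < m} the band. Reducing coordinates mod m maps the
-- pseudo-Frobenius elements of S injectively into B: two axial gaps a·eⱼ and a′·eⱼ with
-- a ≡ a′ (mod m) and a < a′ differ by a nonzero element of S, so the smaller one is not
-- pseudo-Frobenius. Each pair (i, y) ∈ {1..d} × B is attached injectively to a minimal
-- generator of S of degree below 2m (essentially y + m·eᵢ) other than the m·eⱼ, which gives
-- e(S) ≥ d(t(S) + 1). For Wilf's inequality, a point x below a gap is either in S, or a gap
-- lying below a pseudo-Frobenius element f = x + s with s ∈ S; sending (i, x) to (m·eᵢ, x),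
-- resp. to (the generator attached to (i, f mod m), s), injects {1..d} × C into MinGen × N.
-- Membership in T is not decidable, so both arguments run in the double-negation monad;
-- their conclusions are decidable inequalities between naturals.
module Submission where

open import Defs
open import Data.Nat using (ℕ; zero; suc; _+_; _*_; _∸_; _≤_; _<_; z≤n; s≤s; NonZero; >-nonZero)
open import Data.Nat.Properties
open import Data.Nat.DivMod using (_%_; _/_; m≡m%n+[m/n]*n; m%n%n≡m%n; m%n<n; m<n⇒m%n≡m)
open import Data.Nat.Divisibility using (_∣_; _∣?_; ∣m∣n⇒∣m+n; ∣m+n∣m⇒∣n; n∣m*n; ∣1⇒≡1; ∣-refl; _∣0)
open import Data.Nat.Induction using (<-rec)
open import Data.Fin using (Fin; zero; suc)
import Data.Fin.Properties as FinP
open FinP using (all?; ¬∀⟶∃¬)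
open import Data.Vec as Vec using ([]; _∷_; lookup; tabulate)
open import Data.Vec.Properties
  using (≡-dec; tabulate∘lookup; tabulate-cong; lookup-zipWith; lookup∘tabulate; lookup-replicate; lookup-map; zipWith-identityʳ)
open import Data.Vec.Relation.Binary.Pointwise.Inductive using ([]; _∷_)
open import Data.List as List using (List; []; _∷_; length; cartesianProduct; _++_; allFin)
open import Data.List.Properties using (length-++; length-map; length-removeAt′; length-tabulate)
open import Data.List.Membership.Propositional using (_∈_)
open import Data.List.Membership.Propositional.Properties using (∈-cartesianProduct⁻; ∈-cartesianProduct⁺; ∈-map⁻)
open import Data.List.Relation.Unary.Any using (here; there; _─_; index)
open import Data.List.Relation.Unary.All as All using (All; []; _∷_)
open import Data.List.Relation.Unary.AllPairs using ([]; _∷_)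
open import Data.List.Relation.Unary.Unique.Propositional using (Unique)
import Data.List.Relation.Unary.Unique.Propositional.Properties as Unique
open import Data.Product using (_×_; _,_; proj₁; proj₂; ∃; ∃₂; ∃-syntax; uncurry)
open import Data.Sum using (_⊎_; inj₁; inj₂)
open import Data.Maybe using (Maybe; just; nothing)
open import Data.Maybe.Properties using (just-injective)
open import Data.Bool using (if_then_else_)
open import Data.Empty using (⊥-elim)
open import Function using (_∘_; id; case_of_)
open import Level using (0ℓ)
open import Effect.Monad using (RawMonad)
open import Relation.Nullary using (¬_; Dec; yes; no; ¬?; _→-dec_; contradiction)
open import Relation.Nullary.Decidable using (⌊_⌋; decidable-stable; ¬¬-excluded-middle; _×-dec_)
open import Relation.Nullary.Negation using (¬¬-Monad)
open import Relation.Binary.Definitions using (tri<; tri≈; tri>)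
open import Relation.Binary.PropositionalEquality
open import Algebra.Properties.CommutativeSemigroup +-commutativeSemigroup using (interchange)

open RawMonad (¬¬-Monad {a = 0ℓ}) using (pure; _>>=_; rawApplicative)

∈-─ : ∀ {B : Set} {b b′ : B} {bs} (b∈ : b ∈ bs) → b′ ∈ bs → b′ ≢ b → b′ ∈ (bs ─ b∈)
∈-─ (here refl) (here refl) b′≢b = contradiction refl b′≢b
∈-─ (here refl) (there b′∈) _    = b′∈
∈-─ (there b∈)  (here refl) _    = here refl
∈-─ (there b∈)  (there b′∈) b′≢b = there (∈-─ b∈ b′∈ b′≢b)

module _ {A B : Set} (R : A → B → Set) (R-injective : ∀ {x x′ b} → R x b → R x′ b → x ≡ x′) where

  length-≤-by-injection : ∀ {xs ys} → Unique xs → All (λ x → ∃[ b ] R x b × b ∈ ys) xs →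
                          length xs ≤ length ys
  length-≤-by-injection {[]}     _              _                        = z≤n
  length-≤-by-injection {x ∷ xs} {ys} (x∉xs ∷ !xs) ((b , Rxb , b∈ys) ∷ images) =
    ≤-trans (s≤s (length-≤-by-injection !xs (All.zipWith avoid-b (x∉xs , images))))
            (≤-reflexive (sym (length-removeAt′ ys (index b∈ys))))
    where
    avoid-b : ∀ {x′} → x ≢ x′ × (∃[ b′ ] R x′ b′ × b′ ∈ ys) → ∃[ b′ ] R x′ b′ × b′ ∈ (ys ─ b∈ys)
    avoid-b (x≢x′ , b′ , Rx′b′ , b′∈ys) =
      b′ , Rx′b′ , ∈-─ b∈ys b′∈ys (λ { refl → x≢x′ (R-injective Rxb Rx′b′) })

length-cartesianProduct : ∀ {A B : Set} (xs : List A) (ys : List B) →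
                          length (cartesianProduct xs ys) ≡ length xs * length ys
length-cartesianProduct []       ys = refl
length-cartesianProduct (x ∷ xs) ys = begin
  length (List.map (x ,_) ys ++ cartesianProduct xs ys)         ≡⟨ length-++ (List.map (x ,_) ys) ⟩
  length (List.map (x ,_) ys) + length (cartesianProduct xs ys) ≡⟨ cong₂ _+_ (length-map (x ,_) ys) (length-cartesianProduct xs ys) ⟩
  length ys + length xs * length ys                             ∎
  where open ≡-Reasoning

module _ {d : ℕ} where

  ≡-by-lookup : {x y : Pt d} → (∀ k → lookup x k ≡ lookup y k) → x ≡ y
  ≡-by-lookup {x} {y} x≗y = trans (sym (tabulate∘lookup x)) (trans (tabulate-cong x≗y) (tabulate∘lookup y))

  lookup-⊕ : (x y : Pt d) (k : Fin d) → lookup (x ⊕ y) k ≡ lookup x k + lookup y k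
  lookup-⊕ x y k = lookup-zipWith _+_ k x y

  lookup-𝟎 : (k : Fin d) → lookup (𝟎 {d}) k ≡ 0
  lookup-𝟎 k = lookup-replicate k 0

  lookup-·e : (h : ℕ) (i : Fin d) → lookup (h ·e i) i ≡ h
  lookup-·e h i rewrite lookup∘tabulate (λ j → if ⌊ i FinP.≟ j ⌋ then h else 0) i with i FinP.≟ i
  ... | yes _   = refl
  ... | no i≢i = contradiction refl i≢i

  lookup-·e-≢ : (h : ℕ) {i k : Fin d} → i ≢ k → lookup (h ·e i) k ≡ 0
  lookup-·e-≢ h {i} {k} i≢k rewrite lookup∘tabulate (λ j → if ⌊ i FinP.≟ j ⌋ then h else 0) k with i FinP.≟ k
  ... | yes i≡k = contradiction i≡k i≢k
  ... | no _    = refl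

  OnAxis : Fin d → Pt d → Set
  OnAxis i x = ∀ k → i ≢ k → lookup x k ≡ 0

  onAxis? : (i : Fin d) (x : Pt d) → Dec (OnAxis i x)
  onAxis? i x = all? λ k → ¬? (i FinP.≟ k) →-dec lookup x k ≟ 0

  ≡·e : {x : Pt d} {h : ℕ} {i : Fin d} → lookup x i ≡ h → OnAxis i x → x ≡ h ·e i
  ≡·e {x} {h} {i} xᵢ≡h onAxis = ≡-by-lookup λ k → case-on (i FinP.≟ k)
    where
    case-on : ∀ {k} → Dec (i ≡ k) → lookup x k ≡ lookup (h ·e i) k
    case-on (yes refl) = trans xᵢ≡h (sym (lookup-·e h i))
    case-on (no i≢k)   = trans (onAxis _ i≢k) (sym (lookup-·e-≢ h i≢k))

  onAxis-·e : (h : ℕ) (i : Fin d) → OnAxis i (h ·e i)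
  onAxis-·e h i k = lookup-·e-≢ h

  off-axis-positive : {i : Fin d} {x : Pt d} → ¬ OnAxis i x → ∃[ k ] i ≢ k × 0 < lookup x k
  off-axis-positive {i} {x} offAxis with ¬∀⟶∃¬ d _ (λ k → ¬? (i FinP.≟ k) →-dec lookup x k ≟ 0) offAxis
  ... | k , ¬[i≢k→xₖ≡0] with i FinP.≟ k
  ...   | yes i≡k = contradiction (λ i≢k → contradiction i≡k i≢k) ¬[i≢k→xₖ≡0]
  ...   | no i≢k  = k , i≢k , n≢0⇒n>0 (λ xₖ≡0 → ¬[i≢k→xₖ≡0] (λ _ → xₖ≡0))

  ⊕-identityʳ : (x : Pt d) → x ⊕ 𝟎 ≡ x
  ⊕-identityʳ = zipWith-identityʳ +-identityʳ

  ⊕-cancelʳ : (x y z : Pt d) → x ⊕ z ≡ y ⊕ z → x ≡ y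
  ⊕-cancelʳ x y z eq = ≡-by-lookup λ k → +-cancelʳ-≡ (lookup z k) _ _ (begin
    lookup x k + lookup z k ≡⟨ lookup-⊕ x z k ⟨
    lookup (x ⊕ z) k        ≡⟨ cong (λ v → lookup v k) eq ⟩
    lookup (y ⊕ z) k        ≡⟨ lookup-⊕ y z k ⟩
    lookup y k + lookup z k ∎)
    where open ≡-Reasoning

  ·e-distribʳ-+ : (a b : ℕ) (i : Fin d) → (a + b) ·e i ≡ (a ·e i) ⊕ (b ·e i)
  ·e-distribʳ-+ a b i = sym (≡·e
    (trans (lookup-⊕ (a ·e i) (b ·e i) i) (cong₂ _+_ (lookup-·e a i) (lookup-·e b i)))
    (λ k i≢k → trans (lookup-⊕ (a ·e i) (b ·e i) k) (cong₂ _+_ (lookup-·e-≢ a i≢k) (lookup-·e-≢ b i≢k))))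

  map-·e : (f : ℕ → ℕ) → f 0 ≡ 0 → (h : ℕ) (i : Fin d) → Vec.map f (h ·e i) ≡ f h ·e i
  map-·e f f0≡0 h i = ≡·e
    (trans (lookup-map i f (h ·e i)) (cong f (lookup-·e h i)))
    (λ k i≢k → trans (lookup-map k f (h ·e i)) (trans (cong f (lookup-·e-≢ h i≢k)) f0≡0))

  ·e-axis-injective : {h h′ : ℕ} {i i′ : Fin d} → 0 < h → h ·e i ≡ h′ ·e i′ → i ≡ i′
  ·e-axis-injective {h} {h′} {i} {i′} 0<h eq with i FinP.≟ i′
  ... | yes i≡i′ = i≡i′
  ... | no i≢i′  = contradiction
    (trans (sym (lookup-·e h i)) (trans (cong (λ v → lookup v i) eq) (lookup-·e-≢ h′ (i≢i′ ∘ sym))))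
    (≢-sym (<⇒≢ 0<h))

  TwoPositive : Pt d → Set
  TwoPositive x = ∃₂ λ k k′ → k ≢ k′ × 0 < lookup x k × 0 < lookup x k′

  ¬TwoPositive-onAxis : {i : Fin d} {x : Pt d} → OnAxis i x → ¬ TwoPositive x
  ¬TwoPositive-onAxis {i} onAxis (k , k′ , k≢k′ , 0<xₖ , 0<xₖ′) with i FinP.≟ k | i FinP.≟ k′
  ... | yes refl | yes refl = k≢k′ refl
  ... | no i≢k   | _        = <⇒≢ 0<xₖ (sym (onAxis k i≢k))
  ... | _        | no i≢k′  = <⇒≢ 0<xₖ′ (sym (onAxis k′ i≢k′))

  AllBelow : ℕ → Pt d → Set
  AllBelow n x = ∀ k → lookup x k < n

  ⊕≡·e⇒onAxis : {a b : Pt d} {h : ℕ} {j : Fin d} → a ⊕ b ≡ h ·e j → OnAxis j a × OnAxis j b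
  ⊕≡·e⇒onAxis {a} {b} {h} {j} a⊕b≡h·eⱼ =
    (λ k j≢k → m+n≡0⇒m≡0 (lookup a k) (coordinate k j≢k)) , (λ k j≢k → m+n≡0⇒n≡0 (lookup a k) (coordinate k j≢k))
    where
    coordinate : ∀ k → j ≢ k → lookup a k + lookup b k ≡ 0
    coordinate k j≢k = trans (sym (lookup-⊕ a b k)) (trans (cong (λ v → lookup v k) a⊕b≡h·eⱼ) (lookup-·e-≢ h j≢k))

  ⊕≡·e⇒lookup : {a b : Pt d} {h : ℕ} {j : Fin d} → a ⊕ b ≡ h ·e j → lookup a j + lookup b j ≡ h
  ⊕≡·e⇒lookup {a} {b} {h} {j} a⊕b≡h·eⱼ =
    trans (sym (lookup-⊕ a b j)) (trans (cong (λ v → lookup v j) a⊕b≡h·eⱼ) (lookup-·e h j))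

  ¬TwoPositive-·e : (h : ℕ) (i : Fin d) → ¬ TwoPositive (h ·e i)
  ¬TwoPositive-·e h i = ¬TwoPositive-onAxis {x = h ·e i} (onAxis-·e h i)

  ≤-lookup-⊕ˡ : (x s : Pt d) (k : Fin d) → lookup x k ≤ lookup (x ⊕ s) k
  ≤-lookup-⊕ˡ x s k = ≤-trans (m≤m+n _ _) (≤-reflexive (sym (lookup-⊕ x s k)))

  ≤-lookup-⊕ʳ : (x s : Pt d) (k : Fin d) → lookup s k ≤ lookup (x ⊕ s) k
  ≤-lookup-⊕ʳ x s k = ≤-trans (m≤n+m _ _) (≤-reflexive (sym (lookup-⊕ x s k)))

  TwoPositive-⊕ : (x s : Pt d) → TwoPositive x → TwoPositive (x ⊕ s)
  TwoPositive-⊕ x s (k , k′ , k≢k′ , 0<xₖ , 0<xₖ′) =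
    k , k′ , k≢k′ , <-≤-trans 0<xₖ (≤-lookup-⊕ˡ x s k) , <-≤-trans 0<xₖ′ (≤-lookup-⊕ˡ x s k′)

·e-suc : ∀ {d} (h : ℕ) (i : Fin d) → h ·e suc i ≡ 0 ∷ (h ·e i)
·e-suc h i = sym (≡·e (lookup-·e h i) λ
  { zero    _     → refl
  ; (suc k) si≢sk → lookup-·e-≢ h (si≢sk ∘ cong suc) })

·e-zero : ∀ {d} (h : ℕ) → h ·e zero ≡ h ∷ 𝟎 {d}
·e-zero h = sym (≡·e refl λ
  { zero    0≢0 → contradiction refl 0≢0
  ; (suc k) _   → lookup-𝟎 k })

∣⊕∣ : ∀ {d} (x y : Pt d) → ∣ x ⊕ y ∣ₚ ≡ ∣ x ∣ₚ + ∣ y ∣ₚ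
∣⊕∣ []      []      = refl
∣⊕∣ (a ∷ x) (b ∷ y) = trans (cong (a + b +_) (∣⊕∣ x y)) (interchange a b ∣ x ∣ₚ ∣ y ∣ₚ)

∣𝟎∣ : ∀ d → ∣ 𝟎 {d} ∣ₚ ≡ 0
∣𝟎∣ zero    = refl
∣𝟎∣ (suc d) = ∣𝟎∣ d

∣·e∣ : ∀ {d} (h : ℕ) (i : Fin d) → ∣ h ·e i ∣ₚ ≡ h
∣·e∣ {suc d} h zero    = trans (cong ∣_∣ₚ (·e-zero {d} h)) (trans (cong (h +_) (∣𝟎∣ d)) (+-identityʳ h))
∣·e∣ {suc d} h (suc i) = trans (cong ∣_∣ₚ (·e-suc h i)) (∣·e∣ h i)

∣∣≡0⇒≡𝟎 : ∀ {d} (x : Pt d) → ∣ x ∣ₚ ≡ 0 → x ≡ 𝟎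
∣∣≡0⇒≡𝟎 []          _  = refl
∣∣≡0⇒≡𝟎 (zero ∷ x)  eq = cong (0 ∷_) (∣∣≡0⇒≡𝟎 x eq)

lookup≤∣∣ : ∀ {d} (x : Pt d) (k : Fin d) → lookup x k ≤ ∣ x ∣ₚ
lookup≤∣∣ (a ∷ x) zero    = m≤m+n a _
lookup≤∣∣ (a ∷ x) (suc k) = ≤-trans (lookup≤∣∣ x k) (m≤n+m _ a)

≤ₚ-⊕ : ∀ {d} (x s : Pt d) → s ≤ₚ (x ⊕ s)
≤ₚ-⊕ []      []      = []
≤ₚ-⊕ (a ∷ x) (b ∷ s) = m≤n+m b a ∷ ≤ₚ-⊕ x s

∣∣≤∣⊕∣ : ∀ {d} (x s : Pt d) → ∣ s ∣ₚ ≤ ∣ x ⊕ s ∣ₚ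
∣∣≤∣⊕∣ x s = ≤-trans (m≤n+m ∣ s ∣ₚ ∣ x ∣ₚ) (≤-reflexive (sym (∣⊕∣ x s)))

0<∣∣ : ∀ {d} {x : Pt d} → x ≢ 𝟎 → 0 < ∣ x ∣ₚ
0<∣∣ {x = x} x≢𝟎 = n≢0⇒n>0 (x≢𝟎 ∘ ∣∣≡0⇒≡𝟎 x)

≢𝟎⇒positive : ∀ {d} {x : Pt d} → x ≢ 𝟎 → ∃[ j ] 0 < lookup x j
≢𝟎⇒positive {d} {x} x≢𝟎 with ¬∀⟶∃¬ d (λ k → lookup x k ≡ 0) (λ k → lookup x k ≟ 0)
                                 (λ x≗𝟎 → x≢𝟎 (≡-by-lookup λ k → trans (x≗𝟎 k) (sym (lookup-𝟎 k))))
... | j , xⱼ≢0 = j , n≢0⇒n>0 xⱼ≢0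

onAxis-value-positive : ∀ {d} {j : Fin d} {x : Pt d} → OnAxis j x → x ≢ 𝟎 → 0 < lookup x j
onAxis-value-positive {j = j} {x} onAxis x≢𝟎 =
  subst (0 <_) (trans (cong ∣_∣ₚ (≡·e {x = x} refl onAxis)) (∣·e∣ (lookup x j) j)) (0<∣∣ x≢𝟎)

module _ {d : ℕ} {a b : Fin d} (r s : ℕ) (a≢b : a ≢ b) where

  lookup-two-axesˡ : lookup ((r ·e a) ⊕ (s ·e b)) a ≡ r
  lookup-two-axesˡ = trans (lookup-⊕ (r ·e a) (s ·e b) a)
    (trans (cong₂ _+_ (lookup-·e r a) (lookup-·e-≢ s (a≢b ∘ sym))) (+-identityʳ r))

  lookup-two-axesʳ : lookup ((r ·e a) ⊕ (s ·e b)) b ≡ s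
  lookup-two-axesʳ = trans (lookup-⊕ (r ·e a) (s ·e b) b) (cong₂ _+_ (lookup-·e-≢ r a≢b) (lookup-·e s b))

  lookup-two-axes-≢ : ∀ {k} → a ≢ k → b ≢ k → lookup ((r ·e a) ⊕ (s ·e b)) k ≡ 0
  lookup-two-axes-≢ {k} a≢k b≢k = trans (lookup-⊕ (r ·e a) (s ·e b) k) (cong₂ _+_ (lookup-·e-≢ r a≢k) (lookup-·e-≢ s b≢k))

  two-axes-TwoPositive : 0 < r → 0 < s → TwoPositive ((r ·e a) ⊕ (s ·e b))
  two-axes-TwoPositive 0<r 0<s = a , b , a≢b , subst (0 <_) (sym lookup-two-axesˡ) 0<r , subst (0 <_) (sym lookup-two-axesʳ) 0<s

  two-axes-AllBelow : ∀ {n} → 0 < n → r < n → s < n → AllBelow n ((r ·e a) ⊕ (s ·e b))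
  two-axes-AllBelow {n} 0<n r<n s<n k with a FinP.≟ k | b FinP.≟ k
  ... | yes refl | _        = subst (_< n) (sym lookup-two-axesˡ) r<n
  ... | no _     | yes refl = subst (_< n) (sym lookup-two-axesʳ) s<n
  ... | no a≢k   | no b≢k   = subst (_< n) (sym (lookup-two-axes-≢ a≢k b≢k)) 0<n

  ∣two-axes∣ : ∣ (r ·e a) ⊕ (s ·e b) ∣ₚ ≡ r + s
  ∣two-axes∣ = trans (∣⊕∣ (r ·e a) (s ·e b)) (cong₂ _+_ (∣·e∣ r a) (∣·e∣ s b))

¬¬-least : (P : ℕ → Set) {a : ℕ} → P a → ¬ ¬ (∃[ b ] P b × (∀ k → k < b → ¬ P k))
¬¬-least P {a} = <-rec (λ a → P a → ¬ ¬ Least) step a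
  where
  Least = ∃[ b ] P b × (∀ k → k < b → ¬ P k)
  step : ∀ a → (∀ {k} → k < a → P k → ¬ ¬ Least) → P a → ¬ ¬ Least
  step a rec Pa noLeast = noLeast (a , Pa , λ k k<a Pk → rec k<a Pk noLeast)

¬¬-greatest : (P : ℕ → Set) (F : ℕ) → (∀ {b} → P b → b ≤ F) →
              ∀ {a} → P a → ¬ ¬ (∃[ b ] P b × (∀ c → b < c → ¬ P c))
¬¬-greatest P F bounded {a} = go (suc F) (m≤n+m (suc F) a)
  where
  Greatest = ∃[ b ] P b × (∀ c → b < c → ¬ P c)
  go : ∀ n {b} → F < b + n → P b → ¬ ¬ Greatest
  go zero    {b} F<b+0 Pb _          = <⇒≱ (subst (F <_) (+-identityʳ b) F<b+0) (bounded Pb)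
  go (suc n) {b} F<b+1+n Pb noGreatest = noGreatest (b , Pb , λ c b<c Pc →
    go n (<-≤-trans F<b+1+n (≤-trans (≤-reflexive (+-suc b n)) (+-monoˡ-≤ n b<c))) Pc noGreatest)

module _ (T : NumericalSemigroup) where

  gap-below-pseudoFrobenius : ∀ {a} → ¬ (_∈T T a) →
    ¬ ¬ (∃[ b ] ¬ (_∈T T b) × (∃[ c ] _∈T T c × a + c ≡ b) ×
                (∀ c → _∈T T c → 0 < c → ¬ ¬ (_∈T T (b + c))))
  gap-below-pseudoFrobenius {a} a∉T = do
    b , (b∉T , c , c∈T , a+c≡b) , maximal ← ¬¬-greatest GapAbove F bounded (a∉T , 0 , zero∈T T , +-identityʳ a)
    pure (b , b∉T , (c , c∈T , a+c≡b) , λ c′ c′∈T 0<c′ b+c′∉T →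
      maximal (b + c′) (m<m+n b 0<c′)
        (b+c′∉T , c + c′ , +-closed T c c′ c∈T c′∈T , trans (sym (+-assoc a c c′)) (cong (_+ c′) a+c≡b)))
    where
    F = proj₁ (cofinite T)
    GapAbove : ℕ → Set
    GapAbove b = ¬ (_∈T T b) × ∃[ c ] _∈T T c × a + c ≡ b
    bounded : ∀ {b} → GapAbove b → b ≤ F
    bounded (b∉T , _) = ≮⇒≥ (λ F<b → b∉T (proj₂ (cofinite T) _ F<b))

same-remainder-offset : ∀ {a b m} .{{_ : NonZero m}} → a % m ≡ b % m → a / m ≤ b / m →
                        b ≡ a + (b / m ∸ a / m) * m
same-remainder-offset {a} {b} {m} a%m≡b%m a/m≤b/m = begin
  b                                             ≡⟨ m≡m%n+[m/n]*n b m ⟩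
  b % m + b / m * m                             ≡⟨ cong₂ _+_ a%m≡b%m (cong (_* m) (m+[n∸m]≡n a/m≤b/m)) ⟨
  a % m + (a / m + (b / m ∸ a / m)) * m         ≡⟨ cong (a % m +_) (*-distribʳ-+ m (a / m) _) ⟩
  a % m + (a / m * m + (b / m ∸ a / m) * m)     ≡⟨ +-assoc (a % m) _ _ ⟨
  a % m + a / m * m + (b / m ∸ a / m) * m       ≡⟨ cong (_+ (b / m ∸ a / m) * m) (m≡m%n+[m/n]*n a m) ⟨
  a + (b / m ∸ a / m) * m                       ∎
  where open ≡-Reasoning

module Stripe (T : NumericalSemigroup) (m : ℕ) (isMultiplicity : IsMultiplicity T m) (d′ : ℕ) where

  d : ℕ
  d = suc (suc d′)

  S : Pt d → Set
  S = InStripe T m d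

  open Invariants S

  InT : ℕ → Set
  InT = _∈T T

  0<m : 0 < m
  0<m = proj₁ isMultiplicity

  instance
    m≢0 : NonZero m
    m≢0 = >-nonZero 0<m

  multiple∈T : ∀ q → InT (q * m)
  multiple∈T zero    = zero∈T T
  multiple∈T (suc q) = +-closed T m (q * m) (proj₁ (proj₂ isMultiplicity)) (multiple∈T q)

  ·e≢𝟎 : {h : ℕ} {i : Fin d} → 0 < h → h ·e i ≢ 𝟎
  ·e≢𝟎 {h} {i} 0<h h·eᵢ≡𝟎 = <⇒≢ 0<h (trans (sym (∣𝟎∣ d)) (trans (cong ∣_∣ₚ (sym h·eᵢ≡𝟎)) (∣·e∣ h i)))

  InBand : Pt d → Set
  InBand y = 0 < ∣ y ∣ₚ × ∣ y ∣ₚ < m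

  ·e-inBand : {r : ℕ} (j : Fin d) → 0 < r → r < m → InBand (r ·e j)
  ·e-inBand {r} j 0<r r<m = subst (0 <_) (sym (∣·e∣ r j)) 0<r , subst (_< m) (sym (∣·e∣ r j)) r<m

  inBand-·e : {r : ℕ} (j : Fin d) → InBand (r ·e j) → 0 < r × r < m
  inBand-·e {r} j (0<∣r·eⱼ∣ , ∣r·eⱼ∣<m) = subst (0 <_) (∣·e∣ r j) 0<∣r·eⱼ∣ , subst (_< m) (∣·e∣ r j) ∣r·eⱼ∣<m

  ·e∈S : {a : ℕ} (j : Fin d) → ¬ ¬ InT a → S (a ·e j)
  ·e∈S {a} j ¬¬a∈T =
      (λ a·eⱼ∈band → ¬¬a∈T (uncurry (proj₂ (proj₂ isMultiplicity) a) (inBand-·e j a·eⱼ∈band)))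
    , (λ (i , h , h∉T , a·eⱼ≡h·eᵢ) → ¬¬a∈T (subst (λ v → ¬ InT v)
        (trans (sym (∣·e∣ h i)) (trans (cong ∣_∣ₚ (sym a·eⱼ≡h·eᵢ)) (∣·e∣ a j))) h∉T))

  ·e∈S⁻¹ : {a : ℕ} (j : Fin d) → S (a ·e j) → ¬ ¬ InT a
  ·e∈S⁻¹ {a} j a·eⱼ∈S a∉T = proj₂ a·eⱼ∈S (j , a , a∉T , refl)

  𝟎∈S : S 𝟎
  𝟎∈S = subst S (·e-zero 0) (·e∈S zero (pure (zero∈T T)))

  m≤∣∣-of-∈S : {a : Pt d} → S a → a ≢ 𝟎 → m ≤ ∣ a ∣ₚ
  m≤∣∣-of-∈S {a} a∈S a≢𝟎 = ≮⇒≥ λ ∣a∣<m → proj₁ a∈S (0<∣∣ a≢𝟎 , ∣a∣<m)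

  TwoPositive-∈S : {x : Pt d} → TwoPositive x → m ≤ ∣ x ∣ₚ → S x
  TwoPositive-∈S {x} twoPos m≤∣x∣ =
      (λ (_ , ∣x∣<m) → <⇒≱ ∣x∣<m m≤∣x∣)
    , (λ (i , h , _ , x≡h·eᵢ) → ¬TwoPositive-·e h i (subst TwoPositive x≡h·eᵢ twoPos))

  TwoPositive-≢𝟎 : {x : Pt d} → TwoPositive x → x ≢ 𝟎
  TwoPositive-≢𝟎 (k , _ , _ , 0<xₖ , _) refl = <⇒≢ 0<xₖ (sym (lookup-𝟎 k))

  MinGen-if-∣∣<2m : {x : Pt d} → S x → x ≢ 𝟎 → ∣ x ∣ₚ < m + m → MinGen x
  MinGen-if-∣∣<2m {x} x∈S x≢𝟎 ∣x∣<2m = x∈S , x≢𝟎 , λ (a , b , a∈S , b∈S , a≢𝟎 , b≢𝟎 , x≡a⊕b) →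
    <⇒≱ ∣x∣<2m (≤-trans (+-mono-≤ (m≤∣∣-of-∈S a∈S a≢𝟎) (m≤∣∣-of-∈S b∈S b≢𝟎))
                        (≤-reflexive (sym (trans (cong ∣_∣ₚ x≡a⊕b) (∣⊕∣ a b)))))

  MinGen-m·e : (i : Fin d) → MinGen (m ·e i)
  MinGen-m·e i = MinGen-if-∣∣<2m (·e∈S i (pure (proj₁ (proj₂ isMultiplicity)))) (·e≢𝟎 0<m)
    (subst (_< m + m) (sym (∣·e∣ m i)) (m<m+n m 0<m))

  LargeAxialGap : Pt d → Set
  LargeAxialGap p = ∃₂ λ j a → ¬ InT a × m ≤ a × p ≡ a ·e j

  gap-cases : {p : Pt d} → Hole p → ¬ ¬ (InBand p ⊎ LargeAxialGap p)
  gap-cases {p} p∉S neither = p∉S (neither ∘ inj₁ , λ (j , a , a∉T , p≡a·eⱼ) →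
    neither (inj₂ (j , a , a∉T , ≮⇒≥ (λ a<m → neither (inj₁ (subst InBand (sym p≡a·eⱼ)
      (·e-inBand j (n≢0⇒n>0 λ { refl → a∉T (zero∈T T) }) a<m)))) , p≡a·eⱼ)))

  reduce : Pt d → Pt d
  reduce = Vec.map (_% m)

  reduce-inBand : {p : Pt d} → InBand p → reduce p ≡ p
  reduce-inBand {p} (_ , ∣p∣<m) = ≡-by-lookup λ k →
    trans (lookup-map k (_% m) p) (m<n⇒m%n≡m (≤-<-trans (lookup≤∣∣ p k) ∣p∣<m))

  reduce-·e : (a : ℕ) (j : Fin d) → reduce (a ·e j) ≡ (a % m) ·e j
  reduce-·e = map-·e (_% m) (m<n⇒m%n≡m 0<m)

  gap%m≢0 : {a : ℕ} → ¬ InT a → a % m ≢ 0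
  gap%m≢0 {a} a∉T a%m≡0 = a∉T (subst InT (sym (trans (m≡m%n+[m/n]*n a m) (cong (_+ a / m * m) a%m≡0))) (multiple∈T (a / m)))

  reduce-gap-inBand : {p : Pt d} → Hole p → InBand (reduce p)
  reduce-gap-inBand {p} p∉S = decidable-stable ((0 <? ∣ reduce p ∣ₚ) ×-dec (∣ reduce p ∣ₚ <? m)) (do
    inj₂ (j , a , a∉T , _ , refl) ← gap-cases p∉S
      where inj₁ p∈band → pure (subst InBand (sym (reduce-inBand {p} p∈band)) p∈band)
    pure (subst InBand (sym (reduce-·e a j)) (·e-inBand j (n≢0⇒n>0 (gap%m≢0 a∉T)) (m%n<n a m))))

  PF⊕multiple∈S : {p : Pt d} {q : ℕ} → PF p → 0 < q → (j : Fin d) → S (p ⊕ ((q * m) ·e j))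
  PF⊕multiple∈S {q = q} p∈PF 0<q j =
    proj₂ p∈PF _ (·e∈S j (pure (multiple∈T q))) (·e≢𝟎 (<-≤-trans 0<m (m≤n*m m q {{>-nonZero 0<q}})))

  PF-axial-period : {b b′ : ℕ} (j : Fin d) → PF (b ·e j) → b % m ≡ b′ % m → b / m < b′ / m → S (b′ ·e j)
  PF-axial-period {b} {b′} j b∈PF b%m≡b′%m b/m<b′/m = subst S
    (sym (trans (cong (_·e j) (same-remainder-offset b%m≡b′%m (<⇒≤ b/m<b′/m))) (·e-distribʳ-+ b _ j)))
    (PF⊕multiple∈S b∈PF (m<n⇒0<n∸m b/m<b′/m) j)

  PF-axial-injective : {a a′ : ℕ} (j : Fin d) → PF (a ·e j) → PF (a′ ·e j) → a % m ≡ a′ % m → a ≡ a′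
  PF-axial-injective {a} {a′} j a∈PF a′∈PF a%m≡a′%m with <-cmp (a / m) (a′ / m)
  ... | tri< a/m<a′/m _ _ = contradiction (PF-axial-period j a∈PF a%m≡a′%m a/m<a′/m) (proj₁ a′∈PF)
  ... | tri> _ _ a′/m<a/m = contradiction (PF-axial-period j a′∈PF (sym a%m≡a′%m) a′/m<a/m) (proj₁ a∈PF)
  ... | tri≈ _ a/m≡a′/m _ = begin
    a                 ≡⟨ m≡m%n+[m/n]*n a m ⟩
    a % m + a / m * m   ≡⟨ cong₂ _+_ a%m≡a′%m (cong (_* m) a/m≡a′/m) ⟩
    a′ % m + a′ / m * m ≡⟨ m≡m%n+[m/n]*n a′ m ⟨
    a′                ∎
    where open ≡-Reasoning

  reduce-injective-on-PF : {p p′ : Pt d} → PF p → PF p′ → reduce p ≡ reduce p′ → p ≡ p′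
  reduce-injective-on-PF {p} {p′} p∈PF p′∈PF reduce-p≡reduce-p′ = decidable-stable (≡-dec _≟_ p p′) (do
    case ← gap-cases (proj₁ p∈PF)
    case′ ← gap-cases (proj₁ p′∈PF)
    pure (by-cases case case′ p∈PF p′∈PF reduce-p≡reduce-p′))
    where
    band-axial : ∀ {p a j} → InBand p → PF p → PF (a ·e j) → reduce p ≡ reduce (a ·e j) → p ≡ a ·e j
    band-axial {p} {a} {j} p∈band p∈PF a∈PF eq = trans p≡a%m·eⱼ
      (cong (_·e j) (PF-axial-injective j (subst PF p≡a%m·eⱼ p∈PF) a∈PF (m%n%n≡m%n a m)))
      where
      p≡a%m·eⱼ : p ≡ (a % m) ·e j
      p≡a%m·eⱼ = trans (sym (reduce-inBand {p} p∈band)) (trans eq (reduce-·e a j))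

    axial-axial : ∀ {a a′ j j′} → ¬ InT a → PF (a ·e j) → PF (a′ ·e j′) →
                  (a % m) ·e j ≡ (a′ % m) ·e j′ → a ·e j ≡ a′ ·e j′
    axial-axial {a} {a′} {j} {j′} a∉T a∈PF a′∈PF eq
      with refl ← ·e-axis-injective {i = j} {i′ = j′} (n≢0⇒n>0 (gap%m≢0 a∉T)) eq =
      cong (_·e j) (PF-axial-injective j a∈PF a′∈PF
        (trans (sym (∣·e∣ (a % m) j)) (trans (cong ∣_∣ₚ eq) (∣·e∣ (a′ % m) j))))

    by-cases : ∀ {p p′} → InBand p ⊎ LargeAxialGap p → InBand p′ ⊎ LargeAxialGap p′ →
               PF p → PF p′ → reduce p ≡ reduce p′ → p ≡ p′
    by-cases {p} {p′} (inj₁ p∈band) (inj₁ p′∈band) _ _ eq =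
      trans (sym (reduce-inBand {p} p∈band)) (trans eq (reduce-inBand {p′} p′∈band))
    by-cases {p} (inj₁ p∈band) (inj₂ (j , a , _ , _ , refl)) p∈PF a∈PF eq = band-axial {p} {a} {j} p∈band p∈PF a∈PF eq
    by-cases {p′ = p′} (inj₂ (j , a , _ , _ , refl)) (inj₁ p′∈band) a∈PF p′∈PF eq =
      sym (band-axial {p′} {a} {j} p′∈band p′∈PF a∈PF (sym eq))
    by-cases (inj₂ (j , a , a∉T , _ , refl)) (inj₂ (j′ , a′ , _ , _ , refl)) a∈PF a′∈PF eq =
      axial-axial a∉T a∈PF a′∈PF (trans (sym (reduce-·e a j)) (trans eq (reduce-·e a′ j′)))

  TwoPositive-gap-PF : {x : Pt d} → TwoPositive x → Hole x → PF x
  TwoPositive-gap-PF {x} twoPos x∉S = x∉S , λ s s∈S s≢𝟎 →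
    TwoPositive-∈S (TwoPositive-⊕ x s twoPos) (≤-trans (m≤∣∣-of-∈S s∈S s≢𝟎) (∣∣≤∣⊕∣ x s))

  axial-PF : {b : ℕ} (j : Fin d) → ¬ InT b → 0 < b → (∀ c → InT c → 0 < c → ¬ ¬ InT (b + c)) → PF (b ·e j)
  axial-PF {b} j b∉T 0<b b+T∈T = (λ b·eⱼ∈S → ·e∈S⁻¹ j b·eⱼ∈S b∉T) , shift
    where
    shift : ∀ s → S s → s ≢ 𝟎 → S ((b ·e j) ⊕ s)
    shift s s∈S s≢𝟎 with onAxis? j s
    ... | yes onAxis = subst S (trans (·e-distribʳ-+ b c j) (cong ((b ·e j) ⊕_) (sym s≡c·eⱼ)))
                         (·e∈S j (do c∈T ← ·e∈S⁻¹ j (subst S s≡c·eⱼ s∈S)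
                                     b+T∈T c c∈T 0<c))
      where
      c = lookup s j
      s≡c·eⱼ : s ≡ c ·e j
      s≡c·eⱼ = ≡·e refl onAxis
      0<c : 0 < c
      0<c = onAxis-value-positive onAxis s≢𝟎
    ... | no offAxis with off-axis-positive {x = s} offAxis
    ...   | k , j≢k , 0<sₖ = TwoPositive-∈S
            (j , k , j≢k , <-≤-trans (subst (0 <_) (sym (lookup-·e b j)) 0<b) (≤-lookup-⊕ˡ (b ·e j) s j)
                         , <-≤-trans 0<sₖ (≤-lookup-⊕ʳ (b ·e j) s k))
            (≤-trans (m≤∣∣-of-∈S s∈S s≢𝟎) (∣∣≤∣⊕∣ (b ·e j) s))

  gap-below-PF : {x : Pt d} → Hole x → ¬ ¬ (∃[ f ] PF f × ∃[ s ] S s × x ⊕ s ≡ f)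
  gap-below-PF {x} x∉S with ≢𝟎⇒positive (λ x≡𝟎 → x∉S (subst S (sym x≡𝟎) 𝟎∈S))
  ... | j , 0<xⱼ with onAxis? j x
  ...   | yes onAxis = do
    b , b∉T , (c , c∈T , a+c≡b) , b+T∈T ← gap-below-pseudoFrobenius T a∉T
    pure (b ·e j , axial-PF j b∉T (<-≤-trans 0<xⱼ (≤-trans (m≤m+n a c) (≤-reflexive a+c≡b))) b+T∈T ,
          c ·e j , ·e∈S j (pure c∈T) ,
          trans (cong (_⊕ (c ·e j)) x≡a·eⱼ) (trans (sym (·e-distribʳ-+ a c j)) (cong (_·e j) a+c≡b)))
    where
    a = lookup x j
    x≡a·eⱼ : x ≡ a ·e j
    x≡a·eⱼ = ≡·e refl onAxis
    a∉T : ¬ InT a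
    a∉T a∈T = x∉S (subst S (sym x≡a·eⱼ) (·e∈S j (pure a∈T)))
  ...   | no offAxis with off-axis-positive {x = x} offAxis
  ...     | k , j≢k , 0<xₖ = pure (x , TwoPositive-gap-PF (j , k , j≢k , 0<xⱼ , 0<xₖ) x∉S , 𝟎 , 𝟎∈S , ⊕-identityʳ x)

  IsLeastNonMultiple : ℕ → Set
  IsLeastNonMultiple h = InT h × ¬ m ∣ h × (∀ k → k < h → ¬ m ∣ k → ¬ InT k)

  -- A pivot is needed only when m ≥ 2, since otherwise e₀ is not in the band. Being the least
  -- element of T not divisible by m makes h·e₀ a minimal generator other than m·e₀.
  IsPivot : ℕ → Set
  IsPivot h = 2 ≤ m → IsLeastNonMultiple h

  pivot-exists : ¬ ¬ ∃ IsPivot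
  pivot-exists with 2 ≤? m
  ... | no m≱2  = pure (0 , λ 2≤m → contradiction 2≤m m≱2)
  ... | yes 2≤m = do
    h , (h∈T , m∤h) , least ← ¬¬-least (λ x → InT x × ¬ m ∣ x) (proj₂ (cofinite T) c F<c , m∤c)
    pure (h , λ _ → h∈T , m∤h , λ k k<h m∤k k∈T → least k k<h (k∈T , m∤k))
    where
    F = proj₁ (cofinite T)
    c = suc (F * m)
    F<c : F < c
    F<c = s≤s (m≤m*n F m)
    m∤c : ¬ m ∣ c
    m∤c m∣c = <⇒≢ 2≤m (sym (∣1⇒≡1 (∣m+n∣m⇒∣n (subst (m ∣_) (+-comm 1 (F * m)) m∣c) (n∣m*n F))))

  pivot-MinGen : {h : ℕ} → 2 ≤ m → IsLeastNonMultiple h → (j : Fin d) → MinGen (h ·e j)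
  pivot-MinGen {h} 2≤m (h∈T , m∤h , least) j = ·e∈S j (pure h∈T) , ·e≢𝟎 0<h , indecomposable
    where
    0<h : 0 < h
    0<h = n≢0⇒n>0 λ { refl → m∤h (m ∣0) }
    m∣summand : ∀ {x y} → S x → y ≢ 𝟎 → OnAxis j x → OnAxis j y → lookup x j + lookup y j ≡ h → m ∣ lookup x j
    m∣summand {x} x∈S y≢𝟎 x-onAxis y-onAxis xⱼ+yⱼ≡h = decidable-stable (m ∣? lookup x j) λ m∤xⱼ →
      ·e∈S⁻¹ j (subst S (≡·e refl x-onAxis) x∈S)
        (least (lookup x j) (subst (lookup x j <_) xⱼ+yⱼ≡h (m<m+n _ (onAxis-value-positive y-onAxis y≢𝟎))) m∤xⱼ)
    indecomposable : ¬ (∃₂ λ a b → S a × S b × a ≢ 𝟎 × b ≢ 𝟎 × h ·e j ≡ a ⊕ b)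
    indecomposable (a , b , a∈S , b∈S , a≢𝟎 , b≢𝟎 , h·eⱼ≡a⊕b) =
      m∤h (subst (m ∣_) aⱼ+bⱼ≡h (∣m∣n⇒∣m+n (m∣summand a∈S b≢𝟎 a-onAxis b-onAxis aⱼ+bⱼ≡h)
                                          (m∣summand b∈S a≢𝟎 b-onAxis a-onAxis (trans (+-comm (lookup b j) (lookup a j)) aⱼ+bⱼ≡h))))
      where
      a-onAxis = proj₁ (⊕≡·e⇒onAxis (sym h·eⱼ≡a⊕b))
      b-onAxis = proj₂ (⊕≡·e⇒onAxis (sym h·eⱼ≡a⊕b))
      aⱼ+bⱼ≡h = ⊕≡·e⇒lookup (sym h·eⱼ≡a⊕b)

  -- Every attached point has degree in [m, 2m), hence is a minimal generator, and g determines
  -- the case: off-axis points have a coordinate ≥ m, the two completed axial cases have all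
  -- coordinates below m and degree m resp. m + 1, and h·e₀ lies on an axis.
  data Attached (h : ℕ) (g : Pt d) : Fin d → Pt d → Set where
    off-axis      : ∀ {i y} → ¬ OnAxis i y → g ≡ y ⊕ (m ·e i) → Attached h g i y
    on-other-axis : ∀ i r → g ≡ (r ·e suc i) ⊕ ((m ∸ r) ·e zero) → Attached h g (suc i) (r ·e suc i)
    on-first-axis : ∀ r → 2 ≤ r → g ≡ (r ·e zero) ⊕ (suc (m ∸ r) ·e suc zero) → Attached h g zero (r ·e zero)
    unit-vector   : g ≡ h ·e zero → Attached h g zero (1 ·e zero)

  attached-exists : (h : ℕ) (i : Fin d) (y : Pt d) → InBand y → ∃[ g ] Attached h g i y
  attached-exists h i y y∈band with onAxis? i y
  ... | no offAxis = y ⊕ (m ·e i) , off-axis offAxis refl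
  ... | yes onAxis = subst (λ z → ∃[ g ] Attached h g i z) (sym y≡yᵢ·eᵢ)
                       (on-axis i (proj₁ (inBand-·e i (subst InBand y≡yᵢ·eᵢ y∈band))))
    where
    y≡yᵢ·eᵢ : y ≡ lookup y i ·e i
    y≡yᵢ·eᵢ = ≡·e refl onAxis
    on-axis : ∀ i {r} → 0 < r → ∃[ g ] Attached h g i (r ·e i)
    on-axis (suc i) {r}           _ = _ , on-other-axis i r refl
    on-axis zero    {1}           _ = _ , unit-vector refl
    on-axis zero    {suc (suc r)} _ = _ , on-first-axis (suc (suc r)) (s≤s (s≤s z≤n)) refl

  record Flat (g : Pt d) (n : ℕ) : Set where
    field
      twoPositive : TwoPositive g
      allBelow    : AllBelow m g
      size        : ∣ g ∣ₚ ≡ n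

  m≤lookup-⊕m·e : (y : Pt d) (i : Fin d) → m ≤ lookup (y ⊕ (m ·e i)) i
  m≤lookup-⊕m·e y i = ≤-trans (≤-reflexive (sym (lookup-·e m i))) (≤-lookup-⊕ʳ y (m ·e i) i)

  off-axis-TwoPositive : ∀ {g} {i : Fin d} {y : Pt d} → ¬ OnAxis i y → g ≡ y ⊕ (m ·e i) → TwoPositive g
  off-axis-TwoPositive {i = i} {y} offAxis refl with off-axis-positive {x = y} offAxis
  ... | k , i≢k , 0<yₖ = k , i , i≢k ∘ sym , <-≤-trans 0<yₖ (≤-lookup-⊕ˡ y (m ·e i) k)
                       , <-≤-trans 0<m (m≤lookup-⊕m·e y i)

  on-other-axis-Flat : ∀ {g r} (i : Fin (suc d′)) → InBand (r ·e suc i) →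
                       g ≡ (r ·e suc i) ⊕ ((m ∸ r) ·e zero) → Flat g m
  on-other-axis-Flat {r = r} i r·eᵢ∈band refl = record
    { twoPositive = two-axes-TwoPositive r (m ∸ r) sucᵢ≢0 0<r (m<n⇒0<n∸m r<m)
    ; allBelow    = two-axes-AllBelow r (m ∸ r) sucᵢ≢0 0<m r<m (∸-monoʳ-< 0<r (<⇒≤ r<m))
    ; size        = trans (∣two-axes∣ r (m ∸ r) sucᵢ≢0) (m+[n∸m]≡n (<⇒≤ r<m))
    }
    where
    sucᵢ≢0 : suc i ≢ zero
    sucᵢ≢0 ()
    0<r = proj₁ (inBand-·e (suc i) r·eᵢ∈band)
    r<m = proj₂ (inBand-·e (suc i) r·eᵢ∈band)

  on-first-axis-Flat : ∀ {g r} → InBand (r ·e zero) → 2 ≤ r →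
                       g ≡ (r ·e zero) ⊕ (suc (m ∸ r) ·e suc zero) → Flat g (suc m)
  on-first-axis-Flat {r = r} r·e₀∈band 2≤r refl = record
    { twoPositive = two-axes-TwoPositive r (suc (m ∸ r)) 0≢1 (<-≤-trans (s≤s z≤n) 2≤r) (s≤s z≤n)
    ; allBelow    = two-axes-AllBelow r (suc (m ∸ r)) 0≢1 0<m r<m 1+m∸r<m
    ; size        = trans (∣two-axes∣ r (suc (m ∸ r)) 0≢1) (trans (+-suc r (m ∸ r)) (cong suc (m+[n∸m]≡n (<⇒≤ r<m))))
    }
    where
    0≢1 : _≢_ {A = Fin d} zero (suc zero)
    0≢1 ()
    r<m = proj₂ (inBand-·e zero r·e₀∈band)
    1+m∸r<m : suc (m ∸ r) < m
    1+m∸r<m = begin-strict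
      suc (m ∸ r)       <⟨ n<1+n _ ⟩
      2 + (m ∸ r)       ≡⟨ +-comm 2 (m ∸ r) ⟩
      (m ∸ r) + 2       ≤⟨ +-monoʳ-≤ (m ∸ r) 2≤r ⟩
      (m ∸ r) + r       ≡⟨ m∸n+n≡m (<⇒≤ r<m) ⟩
      m                 ∎
      where open ≤-Reasoning

  off-axis-¬Flat : ∀ {g n} {i : Fin d} {y : Pt d} → ¬ OnAxis i y → g ≡ y ⊕ (m ·e i) → ¬ Flat g n
  off-axis-¬Flat {i = i} {y} _ refl flat = <⇒≱ (Flat.allBelow flat i) (m≤lookup-⊕m·e y i)

  Flat-size-unique : ∀ {g} → Flat g m → ¬ Flat g (suc m)
  Flat-size-unique flat flat′ = <⇒≢ (n<1+n m) (trans (sym (Flat.size flat)) (Flat.size flat′))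

  unit-vector-¬TwoPositive : ∀ {g : Pt d} {h : ℕ} → g ≡ h ·e zero → ¬ TwoPositive g
  unit-vector-¬TwoPositive {h = h} refl = ¬TwoPositive-·e h zero

  off-axis-injective : {i i′ : Fin d} {y y′ : Pt d} → InBand y′ → y ⊕ (m ·e i) ≡ y′ ⊕ (m ·e i′) → i ≡ i′ × y ≡ y′
  off-axis-injective {i} {i′} {y} {y′} (_ , ∣y′∣<m) eq with i FinP.≟ i′
  ... | yes refl = refl , ⊕-cancelʳ y y′ (m ·e i) eq
  ... | no i≢i′  = contradiction (m≤lookup-⊕m·e y i) (<⇒≱ (begin-strict
    lookup (y ⊕ (m ·e i)) i             ≡⟨ cong (λ v → lookup v i) eq ⟩
    lookup (y′ ⊕ (m ·e i′)) i           ≡⟨ lookup-⊕ y′ (m ·e i′) i ⟩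
    lookup y′ i + lookup (m ·e i′) i    ≡⟨ cong (lookup y′ i +_) (lookup-·e-≢ m (i≢i′ ∘ sym)) ⟩
    lookup y′ i + 0                     ≡⟨ +-identityʳ _ ⟩
    lookup y′ i                         ≤⟨ lookup≤∣∣ y′ i ⟩
    ∣ y′ ∣ₚ                             <⟨ ∣y′∣<m ⟩
    m                                   ∎))
    where open ≤-Reasoning

  on-other-axis-injective : ∀ {i i′ : Fin (suc d′)} {r r′} → 0 < r →
    (r ·e suc i) ⊕ ((m ∸ r) ·e zero) ≡ (r′ ·e suc i′) ⊕ ((m ∸ r′) ·e zero) → i ≡ i′ × r ≡ r′
  on-other-axis-injective {i} {i′} {r} {r′} 0<r eq with i FinP.≟ i′
  ... | yes refl = refl , trans (sym (lookup-two-axesˡ r (m ∸ r) sucᵢ≢0))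
                                (trans (cong (λ v → lookup v (suc i)) eq) (lookup-two-axesˡ r′ (m ∸ r′) sucᵢ≢0))
    where
    sucᵢ≢0 : suc i ≢ zero
    sucᵢ≢0 ()
  ... | no i≢i′  = ⊥-elim (<⇒≢ 0<r (sym (trans (sym (lookup-two-axesˡ r (m ∸ r) sucᵢ≢0))
                     (trans (cong (λ v → lookup v (suc i)) eq)
                            (lookup-two-axes-≢ r′ (m ∸ r′) sucᵢ′≢0 (i≢i′ ∘ sym ∘ FinP.suc-injective) λ ())))))
    where
    sucᵢ≢0 : suc i ≢ zero
    sucᵢ≢0 ()
    sucᵢ′≢0 : suc i′ ≢ zero
    sucᵢ′≢0 ()

  on-first-axis-injective : ∀ {r r′} →
    _≡_ {A = Pt d} ((r ·e zero) ⊕ (suc (m ∸ r) ·e suc zero)) ((r′ ·e zero) ⊕ (suc (m ∸ r′) ·e suc zero)) → r ≡ r′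
  on-first-axis-injective {r} {r′} eq =
    trans (sym (lookup-two-axesˡ r (suc (m ∸ r)) 0≢1))
          (trans (cong (λ v → lookup v zero) eq) (lookup-two-axesˡ r′ (suc (m ∸ r′)) 0≢1))
    where
    0≢1 : _≢_ {A = Fin d} zero (suc zero)
    0≢1 ()

  attached-injective : ∀ {h g i i′ y y′} → InBand y → InBand y′ →
                       Attached h g i y → Attached h g i′ y′ → i ≡ i′ × y ≡ y′
  attached-injective _ y′∈band (off-axis _ g≡) (off-axis _ g≡′) =
    off-axis-injective y′∈band (trans (sym g≡) g≡′)
  attached-injective _ y′∈band (off-axis off g≡) (on-other-axis i r g≡′) =
    ⊥-elim (off-axis-¬Flat off g≡ (on-other-axis-Flat i y′∈band g≡′))
  attached-injective _ y′∈band (off-axis off g≡) (on-first-axis r 2≤r g≡′) =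
    ⊥-elim (off-axis-¬Flat off g≡ (on-first-axis-Flat y′∈band 2≤r g≡′))
  attached-injective _ _ (off-axis off g≡) (unit-vector g≡′) =
    ⊥-elim (unit-vector-¬TwoPositive g≡′ (off-axis-TwoPositive off g≡))
  attached-injective y∈band _ (on-other-axis i r g≡) (off-axis off g≡′) =
    ⊥-elim (off-axis-¬Flat off g≡′ (on-other-axis-Flat i y∈band g≡))
  attached-injective y∈band _ (on-other-axis i r g≡) (on-other-axis i′ r′ g≡′)
    with refl , refl ← on-other-axis-injective {i} {i′} {r} {r′} (proj₁ (inBand-·e (suc i) y∈band)) (trans (sym g≡) g≡′)
    = refl , refl
  attached-injective y∈band y′∈band (on-other-axis i r g≡) (on-first-axis r′ 2≤r′ g≡′) =
    ⊥-elim (Flat-size-unique (on-other-axis-Flat i y∈band g≡) (on-first-axis-Flat y′∈band 2≤r′ g≡′))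
  attached-injective y∈band _ (on-other-axis i r g≡) (unit-vector g≡′) =
    ⊥-elim (unit-vector-¬TwoPositive g≡′ (Flat.twoPositive (on-other-axis-Flat i y∈band g≡)))
  attached-injective y∈band _ (on-first-axis r 2≤r g≡) (off-axis off g≡′) =
    ⊥-elim (off-axis-¬Flat off g≡′ (on-first-axis-Flat y∈band 2≤r g≡))
  attached-injective y∈band y′∈band (on-first-axis r 2≤r g≡) (on-other-axis i′ r′ g≡′) =
    ⊥-elim (Flat-size-unique (on-other-axis-Flat i′ y′∈band g≡′) (on-first-axis-Flat y∈band 2≤r g≡))
  attached-injective _ _ (on-first-axis r _ g≡) (on-first-axis r′ _ g≡′)
    with refl ← on-first-axis-injective {r} {r′} (trans (sym g≡) g≡′) = refl , refl
  attached-injective y∈band _ (on-first-axis r 2≤r g≡) (unit-vector g≡′) =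
    ⊥-elim (unit-vector-¬TwoPositive g≡′ (Flat.twoPositive (on-first-axis-Flat y∈band 2≤r g≡)))
  attached-injective _ _ (unit-vector g≡) (off-axis off g≡′) =
    ⊥-elim (unit-vector-¬TwoPositive g≡ (off-axis-TwoPositive off g≡′))
  attached-injective _ y′∈band (unit-vector g≡) (on-other-axis i′ r′ g≡′) =
    ⊥-elim (unit-vector-¬TwoPositive g≡ (Flat.twoPositive (on-other-axis-Flat i′ y′∈band g≡′)))
  attached-injective _ y′∈band (unit-vector g≡) (on-first-axis r′ 2≤r′ g≡′) =
    ⊥-elim (unit-vector-¬TwoPositive g≡ (Flat.twoPositive (on-first-axis-Flat y′∈band 2≤r′ g≡′)))
  attached-injective _ _ (unit-vector _) (unit-vector _) = refl , refl

  TwoPositive-MinGen : ∀ {g} → TwoPositive g → m ≤ ∣ g ∣ₚ → ∣ g ∣ₚ < m + m → MinGen g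
  TwoPositive-MinGen twoPos m≤∣g∣ = MinGen-if-∣∣<2m (TwoPositive-∈S twoPos m≤∣g∣) (TwoPositive-≢𝟎 twoPos)

  Flat-MinGen : ∀ {g n} → Flat g n → m ≤ n → n < m + m → MinGen g
  Flat-MinGen {g} flat m≤n n<2m =
    TwoPositive-MinGen (Flat.twoPositive flat) (subst (m ≤_) (sym (Flat.size flat)) m≤n) (subst (_< m + m) (sym (Flat.size flat)) n<2m)

  attached-MinGen : ∀ {h g i y} → IsPivot h → InBand y → Attached h g i y → MinGen g
  attached-MinGen _ (_ , ∣y∣<m) (off-axis {i} {y} off refl) =
    TwoPositive-MinGen (off-axis-TwoPositive {y = y} off refl)
      (subst (m ≤_) (sym ∣y⊕m·eᵢ∣) (m≤n+m m ∣ y ∣ₚ)) (subst (_< m + m) (sym ∣y⊕m·eᵢ∣) (+-monoˡ-< m ∣y∣<m))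
    where
    ∣y⊕m·eᵢ∣ : ∣ y ⊕ (m ·e i) ∣ₚ ≡ ∣ y ∣ₚ + m
    ∣y⊕m·eᵢ∣ = trans (∣⊕∣ y (m ·e i)) (cong (∣ y ∣ₚ +_) (∣·e∣ m i))
  attached-MinGen _ y∈band (on-other-axis i r g≡) =
    Flat-MinGen (on-other-axis-Flat i y∈band g≡) ≤-refl (m<m+n m 0<m)
  attached-MinGen _ y∈band (on-first-axis r 2≤r g≡) =
    Flat-MinGen (on-first-axis-Flat y∈band 2≤r g≡) (n≤1+n m) (subst (_< m + m) (+-comm m 1) (+-monoʳ-< m 1<m))
    where
    1<m : 1 < m
    1<m = <-≤-trans 2≤r (<⇒≤ (proj₂ (inBand-·e zero y∈band)))
  attached-MinGen pivot y∈band (unit-vector refl) = pivot-MinGen 2≤m (pivot 2≤m) zero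
    where
    2≤m : 2 ≤ m
    2≤m = proj₂ (inBand-·e zero y∈band)

  attached-≢-m·e : ∀ {h i y} (k : Fin d) → IsPivot h → InBand y → ¬ Attached h (m ·e k) i y
  attached-≢-m·e k _ _ (off-axis off g≡) = ¬TwoPositive-·e m k (off-axis-TwoPositive off g≡)
  attached-≢-m·e k _ y∈band (on-other-axis i r g≡) = ¬TwoPositive-·e m k (Flat.twoPositive (on-other-axis-Flat i y∈band g≡))
  attached-≢-m·e k _ y∈band (on-first-axis r 2≤r g≡) = ¬TwoPositive-·e m k (Flat.twoPositive (on-first-axis-Flat y∈band 2≤r g≡))
  attached-≢-m·e {h} k pivot y∈band (unit-vector g≡) =
    proj₁ (proj₂ (pivot 2≤m)) (subst (m ∣_) (trans (sym (∣·e∣ m k)) (trans (cong ∣_∣ₚ g≡) (∣·e∣ {d} h zero))) ∣-refl)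
    where
    2≤m : 2 ≤ m
    2≤m = proj₂ (inBand-·e zero y∈band)

  Assigns : ℕ → Fin d × Maybe (Pt d) → Pt d → Set
  Assigns h (i , nothing) g = g ≡ m ·e i
  Assigns h (i , just f)  g = PF f × Attached h g i (reduce f)

  assigns-injective : ∀ {h} → IsPivot h → ∀ {a a′ g} → Assigns h a g → Assigns h a′ g → a ≡ a′
  assigns-injective _ {i , nothing} {i′ , nothing} g≡m·eᵢ g≡m·eᵢ′ =
    cong (_, nothing) (·e-axis-injective 0<m (trans (sym g≡m·eᵢ) g≡m·eᵢ′))
  assigns-injective pivot {i , nothing} {_ , just f′} refl (f′∈PF , attached′) =
    ⊥-elim (attached-≢-m·e i pivot (reduce-gap-inBand (proj₁ f′∈PF)) attached′)
  assigns-injective pivot {_ , just f} {i′ , nothing} (f∈PF , attached) refl =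
    ⊥-elim (attached-≢-m·e i′ pivot (reduce-gap-inBand (proj₁ f∈PF)) attached)
  assigns-injective _ {_ , just f} {_ , just f′} (f∈PF , attached) (f′∈PF , attached′)
    with refl , reduce-f≡reduce-f′ ←
           attached-injective (reduce-gap-inBand (proj₁ f∈PF)) (reduce-gap-inBand (proj₁ f′∈PF)) attached attached′ =
    cong (λ f → _ , just f) (reduce-injective-on-PF f∈PF f′∈PF reduce-f≡reduce-f′)

  assigned-MinGen : ∀ {h} → IsPivot h → (i : Fin d) {f : Pt d} → PF f → ∃[ g ] Assigns h (i , just f) g × MinGen g
  assigned-MinGen {h} pivot i {f} f∈PF with attached-exists h i (reduce f) (reduce-gap-inBand (proj₁ f∈PF))
  ... | g , attached = g , (f∈PF , attached) , attached-MinGen pivot (reduce-gap-inBand (proj₁ f∈PF)) attached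

  e≥d[t+1] : ∀ {e t} → HasCard MinGen e → HasCard PF t → d * (t + 1) ≤ e
  e≥d[t+1] {e} {t} (gens , _ , ∈gens , ∣gens∣≡e) (pfs , !pfs , ∈pfs , ∣pfs∣≡t) =
    decidable-stable (d * (t + 1) ≤? e) (do
      h , pivot ← pivot-exists
      pure (subst₂ _≤_ ∣domain∣ ∣gens∣≡e
        (length-≤-by-injection (Assigns h) (assigns-injective pivot) !domain (All.tabulate (image pivot)))))
    where
    domain : List (Fin d × Maybe (Pt d))
    domain = cartesianProduct (allFin d) (nothing ∷ List.map just pfs)
    !domain : Unique domain
    !domain = Unique.cartesianProduct⁺ (Unique.allFin⁺ d)
      (All.tabulate (λ x∈ → λ { refl → case ∈-map⁻ just x∈ of λ { (_ , _ , ()) } }) ∷ Unique.map⁺ just-injective !pfs)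
    ∣domain∣ : length domain ≡ d * (t + 1)
    ∣domain∣ = trans (length-cartesianProduct (allFin d) (nothing ∷ List.map just pfs))
                     (cong₂ _*_ (length-tabulate {n = d} id) (trans (cong suc (trans (length-map just pfs) ∣pfs∣≡t)) (+-comm 1 t)))
    image : ∀ {h} → IsPivot h → ∀ {a} → a ∈ domain → ∃[ g ] Assigns h a g × g ∈ gens
    image _ {i , nothing} _ = m ·e i , refl , proj₂ (∈gens _) (MinGen-m·e i)
    image pivot {i , just f} a∈domain with ∈-cartesianProduct⁻ (allFin d) (nothing ∷ List.map just pfs) a∈domain
    ... | _ , there just-f∈ with ∈-map⁻ just just-f∈
    ...   | _ , f∈pfs , refl with assigned-MinGen pivot i (proj₁ (∈pfs f) f∈pfs)
    ...     | g , assigns , g∈MinGen = g , assigns , proj₂ (∈gens g) g∈MinGen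

  Offset : Maybe (Pt d) → Pt d → Pt d → Set
  Offset nothing  x s = x ≡ s
  Offset (just f) x s = x ⊕ s ≡ f

  Covers : ℕ → Fin d × Pt d → Pt d × Pt d → Set
  Covers h (i , x) (g , s) = ∃[ o ] Assigns h (i , o) g × Offset o x s

  covers-injective : ∀ {h} → IsPivot h → ∀ {a a′ b} → Covers h a b → Covers h a′ b → a ≡ a′
  covers-injective pivot {i , x} {_ , x′} {_ , s} (o , assigns , offset) (_ , assigns′ , offset′)
    with refl ← assigns-injective pivot assigns assigns′ = cong (i ,_) (offset-injective o offset offset′)
    where
    offset-injective : ∀ o → Offset o x s → Offset o x′ s → x ≡ x′
    offset-injective nothing  x≡s     x′≡s     = trans x≡s (sym x′≡s)
    offset-injective (just f) x⊕s≡f x′⊕s≡f = ⊕-cancelʳ x x′ s (trans x⊕s≡f (sym x′⊕s≡f))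

  dc≤en : ∀ {e n c} → HasCard MinGen e → HasCard NElt n → HasCard CElt c → d * c ≤ e * n
  dc≤en {e} {n} {c} (gens , _ , ∈gens , ∣gens∣≡e) (ns , _ , ∈ns , ∣ns∣≡n) (cs , !cs , ∈cs , ∣cs∣≡c) =
    decidable-stable (d * c ≤? e * n) (do
      h , pivot ← pivot-exists
      images ← All.sequenceA 0ℓ rawApplicative (All.tabulate (image pivot))
      pure (subst₂ _≤_ ∣domain∣ ∣codomain∣ (length-≤-by-injection (Covers h) (covers-injective pivot) !domain images)))
    where
    domain : List (Fin d × Pt d)
    domain = cartesianProduct (allFin d) cs
    !domain : Unique domain
    !domain = Unique.cartesianProduct⁺ (Unique.allFin⁺ d) !cs
    ∣domain∣ : length domain ≡ d * c
    ∣domain∣ = trans (length-cartesianProduct (allFin d) cs) (cong₂ _*_ (length-tabulate {n = d} id) ∣cs∣≡c)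
    ∣codomain∣ : length (cartesianProduct gens ns) ≡ e * n
    ∣codomain∣ = trans (length-cartesianProduct gens ns) (cong₂ _*_ ∣gens∣≡e ∣ns∣≡n)
    image : ∀ {h} → IsPivot h → ∀ {a} → a ∈ domain → ¬ ¬ (∃[ b ] Covers h a b × b ∈ cartesianProduct gens ns)
    image pivot {i , x} a∈domain with proj₁ (∈cs x) (proj₂ (∈-cartesianProduct⁻ (allFin d) cs a∈domain))
    ... | hole , hole∉S , x≤hole = do
      yes x∈S ← ¬¬-excluded-middle
        where no x∉S → do
          f , f∈PF , s , s∈S , x⊕s≡f ← gap-below-PF x∉S
          let g , assigns , g∈MinGen = assigned-MinGen pivot i f∈PF
          pure ((g , s) , (just f , assigns , x⊕s≡f) ,
                ∈-cartesianProduct⁺ (proj₂ (∈gens g) g∈MinGen)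
                  (proj₂ (∈ns s) (s∈S , f , proj₁ f∈PF , subst (s ≤ₚ_) x⊕s≡f (≤ₚ-⊕ x s))))
      pure ((m ·e i , x) , (nothing , refl , refl) ,
            ∈-cartesianProduct⁺ (proj₂ (∈gens _) (MinGen-m·e i)) (proj₂ (∈ns x) (x∈S , hole , hole∉S , x≤hole)))

theorem3p10 : (T : NumericalSemigroup) (m : ℕ) → IsMultiplicity T m →
  (d : ℕ) → 2 ≤ d →
  let S = InStripe T m d
      open Invariants S
  in (e t n c : ℕ) →
     (HasCard MinGen e → HasCard PF t → d * (t + 1) ≤ e) ×
     (HasCard MinGen e → HasCard NElt n → HasCard CElt c → d * c ≤ e * n)
theorem3p10 T m isMultiplicity (suc (suc d′)) (s≤s (s≤s z≤n)) e t n c = e≥d[t+1] , dc≤en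
  where open Stripe T m isMultiplicity d′
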